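{- Let $\mathcal S,\mathcal E$ be disjoint graph transformation systems over $\Lambda$, $A$ a regulation automaton of $\langle\mathcal S,\mathcal E\rangle$, $\mathcal{SE}$ the joint system, $\langle c,d\rangle$ a pair of graph constraints over $\Lambda$, and $k$ a natural number. (i) If $\mathcal{SE}$ is correct w.r.t. $\langle c,d\rangle$, then it is $0$-step correct w.r.t. $\langle c,d\rangle$. (ii) If $\mathcal{SE}$ is $k$-step correct w.r.t. $\langle c,d\rangle$, then it is $(k+1)$-step correct w.r.t. $\langle c,d\rangle$.
   Context: Graphs over $\Lambda$: finite directed graphs with node and edge labels in $\Lambda$. Graph constraints are nested graph conditions over the empty graph ($\mathrm{true}$, $\exists(a,c)$ for injective $a$, $\neg$, $\wedge$) with the usual satisfaction via injective morphisms. Rules $\langle L\hookleftarrow K\hookrightarrow R,ac\rangle$ are applied via double-pushout transformations at injective matches satisfying $ac$; a GTS is a finite set of rules; $\Rightarrow^n,\Rightarrow^*,\Rightarrow^+,\Rightarrow^{\le k}$ denote sequences of direct transformations of length $n$, $\ge0$, $\ge1$, $\le k$ (length $0$ meaning isomorphism). The completion $\overline{\mathcal R}$ of a GTS $\mathcal R$ adds the rule $\mathtt{Skip}=\langle\emptyset\Rightarrow\emptyset\rangle$ with an application condition making it applicable exactly to graphs to which no rule of $\mathcal R$ applies. A regulation automaton is $A=\langle Q,q_0,\delta,\mathrm{sel}\rangle$ with finite $Q$ disjoint from $\Lambda$, $q_0\in Q$, $\delta\subseteq Q\times Q$, $\mathrm{sel}:\delta\to\mathcal P(\mathcal S\cup\mathcal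 E)$. $\langle G,q\rangle$ is $G$ plus a disjoint node labelled $q$. $\mathcal R_A$ ($\mathcal R\in\{\mathcal S,\mathcal E\}$) consists of the rules $\langle\langle L,q\rangle\hookleftarrow K\hookrightarrow\langle R,q'\rangle,ac\rangle$ for $\langle L\hookleftarrow K\hookrightarrow R,ac\rangle\in\mathcal R\cap\mathrm{sel}\langle q,q'\rangle$, $\langle q,q'\rangle\in\delta$; the joint system is $\mathcal{SE}=\mathcal S_A\cup\mathcal E_A$, applied to graphs $\langle G',q_0\rangle$ with $G'$ over $\Lambda$; constraints over $\Lambda$ are evaluated directly on such graphs. A GTS $\mathcal R$ (here $\mathcal{SE}$ or $\mathcal S_A$) is correct w.r.t. $\langle c,d\rangle$ if for every $G=\langle G',q_0\rangle$ with $G\models c$ and every $H$ with $G\Rightarrow^+_{\mathcal R}H$, $H\models d$. $\mathcal{SE}$ is $k$-step correct w.r.t. $\langle c,d\rangle$ if (S) $\mathcal S_A$ is correct w.r.t. $\langle c,d\rangle$ and (R$^k$) for every $G=\langle G',q_0\rangle$ with $G\models c$ and every sequence $G\Rightarrow^*_{\mathcal{SE}}H\Rightarrow_{\mathcal E_A}M\Rightarrow^k_{\overline{\mathcal{SE}}}N$ there is a subsequence $M\Rightarrow^{\le k}_{\overline{\mathcal{SE}}}N'$ (an initial part of the final $k$ steps) with $N'\models d$. -}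

module Defs where

open import Level using (Level)
open import Data.Nat using (ℕ; zero; suc)
open import Data.Fin using (Fin; zero; suc)
open import Data.Sum using (_⊎_; inj₁; inj₂)
open import Data.Product using (Σ; _×_; _,_)
open import Data.Unit using (⊤)
open import Data.Empty using (⊥)
open import Data.List using (List)
open import Data.List.Membership.Propositional using (_∈_)
open import Relation.Nullary using (¬_)
open import Relation.Binary.PropositionalEquality using (_≡_; refl; trans; cong)
open import Function.Definitions using (Injective)

record Graph (L : Set) : Set where
  field
    nV nE : ℕ
    src tgt : Fin nE → Fin nV
    lv : Fin nV → L
    le : Fin nE → L
open Graph public

-- Graph morphisms along a label map φ (φ = identity: ordinary morphisms).
-- Morphisms along inj₁ are used to evaluate conditions over Λ on graphs
-- over Λ ⊎ Q ("evaluated directly").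
record Mor {A B : Set} (φ : A → B) (G : Graph A) (H : Graph B) : Set where
  field
    fV : Fin (nV G) → Fin (nV H)
    fE : Fin (nE G) → Fin (nE H)
    src-pres : ∀ e → fV (src G e) ≡ src H (fE e)
    tgt-pres : ∀ e → fV (tgt G e) ≡ tgt H (fE e)
    lv-pres : ∀ v → lv H (fV v) ≡ φ (lv G v)
    le-pres : ∀ e → le H (fE e) ≡ φ (le G e)
open Mor public

idL : {A : Set} → A → A
idL x = x

Hom : {L : Set} → Graph L → Graph L → Set
Hom = Mor idL

IsInj : {A B : Set} {φ : A → B} {G : Graph A} {H : Graph B} → Mor φ G H → Set
IsInj m = Injective _≡_ _≡_ (fV m) × Injective _≡_ _≡_ (fE m)

idM : {L : Set} (G : Graph L) → Hom G G
idM G = record { fV = idL ; fE = idL ; src-pres = λ _ → refl ; tgt-pres = λ _ → refl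
               ; lv-pres = λ _ → refl ; le-pres = λ _ → refl }

_∘M_ : {A B C : Set} {ψ : B → C} {φ : A → B} {F : Graph A} {G : Graph B} {H : Graph C} →
       Mor ψ G H → Mor φ F G → Mor (λ x → ψ (φ x)) F H
_∘M_ {ψ = ψ} g f = record
  { fV = λ v → fV g (fV f v)
  ; fE = λ e → fE g (fE f e)
  ; src-pres = λ e → trans (cong (fV g) (src-pres f e)) (src-pres g (fE f e))
  ; tgt-pres = λ e → trans (cong (fV g) (tgt-pres f e)) (tgt-pres g (fE f e))
  ; lv-pres = λ v → trans (lv-pres g (fV f v)) (cong ψ (lv-pres f v))
  ; le-pres = λ e → trans (le-pres g (fE f e)) (cong ψ (le-pres f e))
  }

_≈M_ : {A B : Set} {φ ψ : A → B} {G : Graph A} {H : Graph B} → Mor φ G H → Mor ψ G H → Set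
f ≈M g = (∀ v → fV f v ≡ fV g v) × (∀ e → fE f e ≡ fE g e)

_≅_ : {L : Set} → Graph L → Graph L → Set
G ≅ H = Σ (Hom G H) λ f → Σ (Hom H G) λ g → ((g ∘M f) ≈M idM G) × ((f ∘M g) ≈M idM H)

∅G : {L : Set} → Graph L
∅G = record { nV = 0 ; nE = 0 ; src = λ () ; tgt = λ () ; lv = λ () ; le = λ () }

initMor : {A B : Set} (φ : A → B) (G : Graph B) → Mor φ ∅G G
initMor φ G = record { fV = λ () ; fE = λ () ; src-pres = λ () ; tgt-pres = λ ()
                     ; lv-pres = λ () ; le-pres = λ () }

IsPushout : {L : Set} {A B C D : Graph L} →
            Hom A B → Hom A C → Hom B D → Hom C D → Set
IsPushout {L} {A} {B} {C} {D} f g f' g' =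
  ((f' ∘M f) ≈M (g' ∘M g)) ×
  ((X : Graph L) (x₁ : Hom B X) (x₂ : Hom C X) → (x₁ ∘M f) ≈M (x₂ ∘M g) →
     Σ (Hom D X) λ u → ((u ∘M f') ≈M x₁) × ((u ∘M g') ≈M x₂) ×
       ((u' : Hom D X) → (u' ∘M f') ≈M x₁ → (u' ∘M g') ≈M x₂ → u' ≈M u))

DPO : {Lb : Set} {K L R G : Graph Lb} → Hom K L → Hom K R → Hom L G → Graph Lb → Set
DPO {Lb} {K} {L} {R} {G} l r m H =
  Σ (Graph Lb) λ D → Σ (Hom K D) λ k → Σ (Hom D G) λ g → Σ (Hom D H) λ h → Σ (Hom R H) λ n →
    IsPushout l k m g × IsPushout r k n h

data Cond {L : Set} : Graph L → Set where
  true : {P : Graph L} → Cond P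
  ex   : {P : Graph L} (C : Graph L) (a : Hom P C) → IsInj a → Cond C → Cond P
  neg  : {P : Graph L} → Cond P → Cond P
  and  : {P : Graph L} → Cond P → Cond P → Cond P

Sat : {A B : Set} {φ : A → B} {P : Graph A} {G : Graph B} → Mor φ P G → Cond P → Set
Sat p true = ⊤
Sat {φ = φ} {G = G} p (ex C a _ c) =
  Σ (Mor φ C G) λ q → IsInj q × ((q ∘M a) ≈M p) × Sat q c
Sat p (neg c) = ¬ Sat p c
Sat p (and c d) = Sat p c × Sat p d

Constraint : Set → Set
Constraint L = Cond {L} ∅G

_⊨_ : {Λ Q : Set} → Graph (Λ ⊎ Q) → Constraint Λ → Set
G ⊨ c = Sat (initMor inj₁ G) c

record Rule (L : Set) : Set where
  field
    Lg Kg Rg : Graph L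
    l : Hom Kg Lg
    r : Hom Kg Rg
    l-inj : IsInj l
    r-inj : IsInj r
    ac : Cond Lg
open Rule public

GTS : Set → Set
GTS L = List (Rule L)

Disjoint : {L : Set} → GTS L → GTS L → Set
Disjoint S E = ∀ ρ → ρ ∈ S → ρ ∈ E → ⊥

record Automaton {Λ : Set} (S E : GTS Λ) : Set where
  field
    nQ  : ℕ
    q₀  : Fin nQ
    δ   : List (Fin nQ × Fin nQ)
    sel : Fin nQ × Fin nQ → List (Rule Λ)
    sel-sub : ∀ t → t ∈ δ → ∀ ρ → ρ ∈ sel t → (ρ ∈ S) ⊎ (ρ ∈ E)
open Automaton public

relabel : {A B : Set} → (A → B) → Graph A → Graph B
relabel f G = record { nV = nV G ; nE = nE G ; src = src G ; tgt = tgt G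
                     ; lv = λ v → f (lv G v) ; le = λ e → f (le G e) }

addNode : {B : Set} → B → Graph B → Graph B
addNode ℓ G = record { nV = suc (nV G) ; nE = nE G
                     ; src = λ e → suc (src G e) ; tgt = λ e → suc (tgt G e)
                     ; lv = lvn ; le = le G }
  where
    lvn : Fin (suc (nV G)) → _
    lvn zero = ℓ
    lvn (suc v) = lv G v

⟨_,_⟩ : {Λ : Set} {n : ℕ} → Graph Λ → Fin n → Graph (Λ ⊎ Fin n)
⟨ G , q ⟩ = addNode (inj₂ q) (relabel inj₁ G)

liftMor : {Λ : Set} {n : ℕ} {K L : Graph Λ} (q : Fin n) →
          Hom K L → Hom (relabel inj₁ K) ⟨ L , q ⟩
liftMor q f = record
  { fV = λ v → suc (fV f v) ; fE = fE f
  ; src-pres = λ e → cong suc (src-pres f e)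
  ; tgt-pres = λ e → cong suc (tgt-pres f e)
  ; lv-pres = λ v → cong inj₁ (lv-pres f v)
  ; le-pres = λ e → cong inj₁ (le-pres f e) }

ι : {Λ : Set} {n : ℕ} (L : Graph Λ) (q : Fin n) → Mor inj₁ L ⟨ L , q ⟩
ι L q = record { fV = suc ; fE = idL ; src-pres = λ _ → refl ; tgt-pres = λ _ → refl
               ; lv-pres = λ _ → refl ; le-pres = λ _ → refl }

module _ {Λ : Set} {S E : GTS Λ} (A : Automaton S E) where

  CGraph : Set
  CGraph = Graph (Λ ⊎ Fin (nQ A))

  -- direct transformation with a rule of R_A  (R ∈ {S , E}):
  -- rule ⟨⟨L,q⟩ ↩ K ↪ ⟨R,q'⟩, ac⟩ for ρ ∈ R ∩ sel⟨q,q'⟩, ⟨q,q'⟩ ∈ δ;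
  -- ac (over L) is checked on the restriction of the match to L.
  StepA : GTS Λ → CGraph → CGraph → Set
  StepA R G H =
    Σ (Fin (nQ A)) λ q → Σ (Fin (nQ A)) λ q' → ((q , q') ∈ δ A) ×
    Σ (Rule Λ) λ ρ → (ρ ∈ R) × (ρ ∈ sel A (q , q')) ×
    Σ (Hom ⟨ Lg ρ , q ⟩ G) λ m → IsInj m × Sat (m ∘M ι (Lg ρ) q) (ac ρ) ×
      DPO (liftMor q (l ρ)) (liftMor q' (r ρ)) m H

  StepS StepE StepSE StepSEbar : CGraph → CGraph → Set
  StepS = StepA S
  StepE = StepA E
  StepSE G H = StepA S G H ⊎ StepA E G H
  -- completion: additionally Skip = ⟨∅ ⇒ ∅⟩, applicable exactly when no rule of SE applies
  StepSEbar G H =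
    StepSE G H ⊎
    ((¬ Σ CGraph λ H' → StepSE G H') ×
      DPO (initMor idL ∅G) (initMor idL ∅G) (initMor idL G) H)

  data Seq (step : CGraph → CGraph → Set) : ℕ → CGraph → CGraph → Set where
    nil  : {G H : CGraph} → G ≅ H → Seq step 0 G H
    cons : {n : ℕ} {G G₁ H : CGraph} → step G G₁ → Seq step n G₁ H → Seq step (suc n) G H

  graphAt : {step : CGraph → CGraph → Set} {n : ℕ} {G H : CGraph} →
            Seq step n G H → Fin (suc n) → CGraph
  graphAt {G = G} s zero = G
  graphAt (nil _) (suc ())
  graphAt (cons _ s) (suc j) = graphAt s j

  Star Plus : (CGraph → CGraph → Set) → CGraph → CGraph → Set
  Star step G H = Σ ℕ λ n → Seq step n G H
  Plus step G H = Σ ℕ λ n → Seq step (suc n) G H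

  start : Graph Λ → CGraph
  start G' = ⟨ G' , q₀ A ⟩

  Correct : (CGraph → CGraph → Set) → Constraint Λ → Constraint Λ → Set
  Correct step c d = (G' : Graph Λ) → start G' ⊨ c →
                     (H : CGraph) → Plus step (start G') H → H ⊨ d

  CondR : ℕ → Constraint Λ → Constraint Λ → Set
  CondR k c d = (G' : Graph Λ) → start G' ⊨ c →
    (H M N : CGraph) → Star StepSE (start G') H → StepE H M →
    (s : Seq StepSEbar k M N) → Σ (Fin (suc k)) λ j → graphAt s j ⊨ d

  StepCorrect : ℕ → Constraint Λ → Constraint Λ → Set
  StepCorrect k c d = Correct StepS c d × CondR k c d

-- (i) An S_A-derivation is an SE-derivation, and the graph M reached by an E_A-step after an
-- SE-derivation is itself the end of a non-empty SE-derivation, so M ⊨ d already at step 0.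
-- (ii) The first k steps of a window of k + 1 steps after M form a window of k steps, and the
-- graph satisfying d there also occurs in the longer window.
-- Since derivations of length 0 are isomorphisms, appending a step requires transporting it
-- along an isomorphism: satisfaction and pushout squares are invariant under isomorphism.
module Submission where

open import Defs
open import Data.Nat using (ℕ; zero; suc)
open import Data.Fin using (zero; suc; inject₁)
open import Data.Product using (Σ; _×_; _,_; proj₁)
open import Data.Sum using (inj₁; inj₂)
import Data.Sum as Sum
open import Function.Consequences.Propositional using (inverseʳ⇒injective; strictlyInverseʳ⇒inverseʳ)
import Function.Construct.Composition as Composition
open import Relation.Binary.PropositionalEquality using (_≡_; refl; sym; trans; cong; subst)

private
  variable
    A B C D : Set
    φ ψ χ : A → B

-- _≈M_ reduces to pointwise equations, so the morphisms it relates cannot be inferred from a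
-- proof of it; the lemmas below are therefore often given their morphisms by name.
≈M-sym : {G : Graph A} {H : Graph B} {f : Mor φ G H} {g : Mor ψ G H} → f ≈M g → g ≈M f
≈M-sym (eV , eE) = (λ v → sym (eV v)) , (λ e → sym (eE e))

≈M-trans : {G : Graph A} {H : Graph B} {f : Mor φ G H} {g : Mor ψ G H} {h : Mor χ G H} →
           f ≈M g → g ≈M h → f ≈M h
≈M-trans (eV , eE) (eV′ , eE′) = (λ v → trans (eV v) (eV′ v)) , (λ e → trans (eE e) (eE′ e))

∘M-resp-≈ʳ : {F : Graph A} {G : Graph B} {H : Graph C} {f : Mor φ F G} {g : Mor ψ F G}
             (h : Mor χ G H) → f ≈M g → (h ∘M f) ≈M (h ∘M g)
∘M-resp-≈ʳ h (eV , eE) = (λ v → cong (fV h) (eV v)) , (λ e → cong (fE h) (eE e))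

∘M-assoc : {F : Graph A} {G : Graph B} {H : Graph C} {I : Graph D}
           (h : Mor χ H I) (g : Mor ψ G H) (f : Mor φ F G) → (h ∘M (g ∘M f)) ≈M ((h ∘M g) ∘M f)
∘M-assoc h g f = (λ _ → refl) , (λ _ → refl)

IsInj-∘ : {F : Graph A} {G : Graph B} {H : Graph C} {g : Mor ψ G H} {f : Mor φ F G} →
          IsInj g → IsInj f → IsInj (g ∘M f)
IsInj-∘ (gV , gE) (fV , fE) =
  Composition.injective _≡_ _≡_ _≡_ fV gV , Composition.injective _≡_ _≡_ _≡_ fE gE

Sat-cong : {P : Graph A} {G : Graph B} {p p′ : Mor φ P G} (c : Cond P) →
           p ≈M p′ → Sat p c → Sat p′ c
Sat-cong true p≈p′ s = s
Sat-cong {p = p} {p′} (ex C a _ c) p≈p′ (q , q-inj , qa≈p , s) =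
  q , q-inj , ≈M-trans {f = q ∘M a} {p} {p′} qa≈p p≈p′ , s
Sat-cong {p = p} {p′} (neg c) p≈p′ ¬s s = ¬s (Sat-cong c (≈M-sym {f = p} {p′} p≈p′) s)
Sat-cong (and c d) p≈p′ (s , t) = Sat-cong c p≈p′ s , Sat-cong d p≈p′ t

module _ {L : Set} where

  ≅-refl : (G : Graph L) → G ≅ G
  ≅-refl G = idM G , idM G , ((λ _ → refl) , (λ _ → refl)) , ((λ _ → refl) , (λ _ → refl))

  ≅-sym : {G H : Graph L} → G ≅ H → H ≅ G
  ≅-sym (to , from , from∘to , to∘from) = from , to , to∘from , from∘to

  ≅⇒IsInj : {G H : Graph L} (i : G ≅ H) → IsInj (proj₁ i)
  ≅⇒IsInj (to , from , (fromtoV , fromtoE) , _) =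
    inverseʳ⇒injective (fV to) (strictlyInverseʳ⇒inverseʳ {f⁻¹ = fV from} (fV to) fromtoV) ,
    inverseʳ⇒injective (fE to) (strictlyInverseʳ⇒inverseʳ {f⁻¹ = fE from} (fE to) fromtoE)

  ≅-cancel : {F : Graph A} {G H : Graph L} {X : Graph B} (i : G ≅ H) (u : Mor ψ G X) (p : Mor φ F G) →
             ((u ∘M proj₁ (≅-sym i)) ∘M (proj₁ i ∘M p)) ≈M (u ∘M p)
  ≅-cancel (_ , _ , (fromtoV , fromtoE) , _) u p =
    (λ v → cong (fV u) (fromtoV (fV p v))) , (λ e → cong (fE u) (fromtoE (fE p e)))

  Sat-≅ : {P : Graph A} {G H : Graph L} (i : G ≅ H) (p : Mor φ P G) (c : Cond P) →
          Sat p c → Sat (proj₁ i ∘M p) c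
  Sat-≅ i p true s = s
  Sat-≅ i p (ex C a _ c) (q , q-inj , qa≈p , s) =
    proj₁ i ∘M q ,
    IsInj-∘ {g = proj₁ i} {q} (≅⇒IsInj i) q-inj ,
    ∘M-resp-≈ʳ {f = q ∘M a} {p} (proj₁ i) qa≈p ,
    Sat-≅ i q c s
  Sat-≅ i p (neg c) ¬s s =
    ¬s (Sat-cong {p = proj₁ (≅-sym i) ∘M (proj₁ i ∘M p)} {p} c (≅-cancel i (idM _) p)
                 (Sat-≅ (≅-sym i) (proj₁ i ∘M p) c s))
  Sat-≅ i p (and c d) (s , t) = Sat-≅ i p c s , Sat-≅ i p d t

  IsPushout-≅ : {K G H M M′ : Graph L} {f : Hom K G} {g : Hom K H} {f′ : Hom G M} {g′ : Hom H M}
                (i : M ≅ M′) → IsPushout f g f′ g′ →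
                IsPushout f g (proj₁ i ∘M f′) (proj₁ i ∘M g′)
  IsPushout-≅ {f = f} {g} {f′} {g′} i@(to , from , _ , (tofromV , tofromE)) (commutes , universal) =
    ∘M-resp-≈ʳ {f = f′ ∘M f} {g′ ∘M g} to commutes ,
    λ X x₁ x₂ x-commutes →
      let (u , uf′≈x₁ , ug′≈x₂ , unique) = universal X x₁ x₂ x-commutes in
      u ∘M from ,
      ≈M-trans {f = (u ∘M from) ∘M (to ∘M f′)} {u ∘M f′} {x₁} (≅-cancel i u f′) uf′≈x₁ ,
      ≈M-trans {f = (u ∘M from) ∘M (to ∘M g′)} {u ∘M g′} {x₂} (≅-cancel i u g′) ug′≈x₂ ,
      λ u′ u′f′≈x₁ u′g′≈x₂ →
        let (u′toV , u′toE) = unique (u′ ∘M to) u′f′≈x₁ u′g′≈x₂ in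
        (λ v → trans (cong (fV u′) (sym (tofromV v))) (u′toV (fV from v))) ,
        (λ e → trans (cong (fE u′) (sym (tofromE e))) (u′toE (fE from e)))

module _ {Λ : Set} {S E : GTS Λ} (A : Automaton S E) where

  StepA-≅ : (R : GTS Λ) {G H M : CGraph A} → G ≅ H → StepA A R H M → StepA A R G M
  StepA-≅ R {G} {H} G≅H
    (q , q′ , qq′∈δ , ρ , ρ∈R , ρ∈sel , m , m-inj , m⊨ac , D , k , g , h , n , po₁ , po₂) =
    q , q′ , qq′∈δ , ρ , ρ∈R , ρ∈sel ,
    from ∘M m , IsInj-∘ {g = from} {m} (≅⇒IsInj H≅G) m-inj ,
    Sat-cong (ac ρ) (∘M-assoc from m (ι (Lg ρ) q)) (Sat-≅ H≅G (m ∘M ι (Lg ρ) q) (ac ρ) m⊨ac) ,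
    D , k , from ∘M g , h , n , IsPushout-≅ {f = liftMor q (l ρ)} {k} {m} {g} H≅G po₁ , po₂
    where
      H≅G : H ≅ G
      H≅G = ≅-sym G≅H
      from : Hom H G
      from = proj₁ H≅G

  StepSE-≅ : {G H M : CGraph A} → G ≅ H → StepSE A H M → StepSE A G M
  StepSE-≅ G≅H = Sum.map (StepA-≅ S G≅H) (StepA-≅ E G≅H)

  module _ {step : CGraph A → CGraph A → Set} where

    Seq-map : {step′ : CGraph A → CGraph A → Set} → (∀ {G H} → step G H → step′ G H) →
              {n : ℕ} {G H : CGraph A} → Seq A step n G H → Seq A step′ n G H
    Seq-map f (nil G≅H) = nil G≅H
    Seq-map f (cons st s) = cons (f st) (Seq-map f s)

    Seq-snoc : (∀ {G H M} → G ≅ H → step H M → step G M) →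
               {n : ℕ} {G H M : CGraph A} → Seq A step n G H → step H M → Seq A step (suc n) G M
    Seq-snoc step-≅ (nil G≅H) st = cons (step-≅ G≅H st) (nil (≅-refl _))
    Seq-snoc step-≅ (cons st′ s) st = cons st′ (Seq-snoc step-≅ s st)

    Seq-init : (n : ℕ) {G N : CGraph A} (s : Seq A step (suc n) G N) →
               Σ (CGraph A) λ N′ → Σ (Seq A step n G N′) λ t →
                 ∀ j → graphAt A t j ≡ graphAt A s (inject₁ j)
    Seq-init zero {G} (cons _ _) = G , nil (≅-refl G) , λ { zero → refl }
    Seq-init (suc n) (cons st s) =
      let (N′ , t , t≡s) = Seq-init n s in
      N′ , cons st t , λ { zero → refl ; (suc j) → t≡s j }

  module _ {c d : Constraint Λ} where

    correct⇒stepCorrect₀ : Correct A (StepSE A) c d → StepCorrect A 0 c d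
    correct⇒stepCorrect₀ correct =
      (λ G′ G⊨c H (n , s) → correct G′ G⊨c H (n , Seq-map inj₁ s)) ,
      (λ G′ G⊨c H M _ (n , s) st _ →
         zero , correct G′ G⊨c M (n , Seq-snoc StepSE-≅ s (inj₂ st)))

    stepCorrect-suc : {k : ℕ} → StepCorrect A k c d → StepCorrect A (suc k) c d
    stepCorrect-suc {k} (correctS , condR) = correctS , λ G′ G⊨c H M N s st window →
      let (N′ , prefix , prefix≡window) = Seq-init k window
          (j , Nj⊨d) = condR G′ G⊨c H M N′ s st prefix in
      inject₁ j , subst (_⊨ d) (prefix≡window j) Nj⊨d

mainTheorem5 : {Λ : Set} (S E : GTS Λ) → Disjoint S E → (A : Automaton S E) →
               (c d : Constraint Λ) (k : ℕ) →
               (Correct A (StepSE A) c d → StepCorrect A 0 c d) ×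
               (StepCorrect A k c d → StepCorrect A (suc k) c d)
mainTheorem5 S E _ A c d k = correct⇒stepCorrect₀ A , stepCorrect-suc A
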